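{- Let $X$ be a nonempty set and $n\ge1$. If $\mathcal{U}$ and $\mathcal{H}$ are $n$-minimal constructible families of subsets of $X$, then $\mathcal{U}\cap\mathcal{H}$ is $n$-minimal constructible.
   Context: For a family $\mathcal{U}$ of subsets of $X$, let $C_1(\mathcal{U})$ be the family of all sets of the form $E_1\cap E_2$, $E_1\cup E_2$ or $X\setminus E_1$ with $E_1,E_2\in\mathcal{U}$ (possibly $E_1=E_2$). Set $C_0(\mathcal{U})=\mathcal{U}$ and $C_n(\mathcal{U})=C_1(C_{n-1}(\mathcal{U}))$ for $n\ge1$. A family $\mathcal{U}$ is $n$-minimal constructible ($n\ge1$) if for every proper subfamily $\mathcal{H}\subsetneq\mathcal{U}$ we have $\mathcal{U}\not\subseteq C_n(\mathcal{H})$. -}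

module Defs where

open import Level using (Level) renaming (suc to lsuc)
open import Data.Nat using (ℕ; zero; suc)
open import Data.Product using (Σ; ∃; ∃-syntax; _×_; _,_)
open import Data.Sum using (_⊎_)
open import Relation.Nullary using (¬_)
open import Relation.Unary using (Pred; _∩_; _∪_; ∁; _≐_)

Subset : ∀ {ℓ} → Set ℓ → Set (lsuc ℓ)
Subset {ℓ} X = Pred X ℓ

Family : ∀ {ℓ} → Set ℓ → Set (lsuc (lsuc ℓ))
Family {ℓ} X = Pred (Subset X) (lsuc ℓ)

module _ {ℓ : Level} {X : Set ℓ} where

  -- Membership of a subset in a family, up to extensional equality of subsets
  -- (families are sets of subsets, and subsets are equal when extensionally equal).
  _∈F_ : Subset X → Family X → Set (lsuc ℓ)
  E ∈F U = ∃[ E′ ] (U E′ × (E′ ≐ E))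

  _⊆F_ : Family X → Family X → Set (lsuc ℓ)
  H ⊆F U = ∀ E → E ∈F H → E ∈F U

  _⊊F_ : Family X → Family X → Set (lsuc ℓ)
  H ⊊F U = (H ⊆F U) × ∃[ E ] (E ∈F U × ¬ (E ∈F H))

  _∩F_ : Family X → Family X → Family X
  (U ∩F H) E = (E ∈F U) × (E ∈F H)

  C₁ : Family X → Family X
  C₁ U E = ∃[ E₁ ] ∃[ E₂ ] (U E₁ × U E₂ ×
             ((E ≐ (E₁ ∩ E₂)) ⊎ (E ≐ (E₁ ∪ E₂)) ⊎ (E ≐ ∁ E₁)))

  C : ℕ → Family X → Family X
  C zero    U = U
  C (suc n) U = C₁ (C n U)

  MinimalConstructible : ℕ → Family X → Set (lsuc (lsuc ℓ))
  MinimalConstructible n U = ∀ H → H ⊊F U → ¬ (U ⊆F C n H)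

-- A subfamily of an n-minimal constructible family is again n-minimal
-- constructible, and U ∩ H is a subfamily of U. For the first fact, let K ⊊ W ⊆ U
-- with W ⊆ Cₙ(K). Put back the sets of U that W dropped: K′ = K ∪ (U ∖ W) is still
-- a proper subfamily of U (it misses what K misses in W), and U ⊆ Cₙ(K′), because
-- each member of U either lies in W ⊆ Cₙ(K) or is itself a member of K′.
module Submission where

open import Defs
open import Level using (Level) renaming (suc to lsuc)
open import Data.Nat using (ℕ; _≤_; zero; suc)
open import Axiom.ExcludedMiddle using (ExcludedMiddle)
open import Data.Product using (_×_; _,_; proj₁)
open import Data.Sum using (_⊎_; inj₁; inj₂)
open import Function using (_∘_)
open import Relation.Nullary using (¬_; yes; no)
open import Relation.Unary using (_∩_; _∪_; ∁; _≐_)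
open import Relation.Unary.Properties using (≐-refl; ≐-sym; ≐-trans)

module _ {ℓ : Level} {X : Set ℓ} where

  ∩-cong : {A A′ B B′ : Subset X} → A ≐ A′ → B ≐ B′ → (A ∩ B) ≐ (A′ ∩ B′)
  ∩-cong (A⊆A′ , A′⊆A) (B⊆B′ , B′⊆B) =
    (λ (a , b) → A⊆A′ a , B⊆B′ b) , (λ (a , b) → A′⊆A a , B′⊆B b)

  ∪-cong : {A A′ B B′ : Subset X} → A ≐ A′ → B ≐ B′ → (A ∪ B) ≐ (A′ ∪ B′)
  ∪-cong (A⊆A′ , A′⊆A) (B⊆B′ , B′⊆B) =
    (λ { (inj₁ a) → inj₁ (A⊆A′ a) ; (inj₂ b) → inj₂ (B⊆B′ b) }) ,
    (λ { (inj₁ a) → inj₁ (A′⊆A a) ; (inj₂ b) → inj₂ (B′⊆B b) })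

  ∁-cong : {A A′ : Subset X} → A ≐ A′ → ∁ A ≐ ∁ A′
  ∁-cong (A⊆A′ , A′⊆A) = (λ ¬a → ¬a ∘ A′⊆A) , (λ ¬a′ → ¬a′ ∘ A⊆A′)

  ∈F-resp-≐ : {E E′ : Subset X} {U : Family X} → E ∈F U → E ≐ E′ → E′ ∈F U
  ∈F-resp-≐ (F , F∈U , F≐E) E≐E′ = F , F∈U , ≐-trans F≐E E≐E′

  ∈F-reflexive : {E : Subset X} {U : Family X} → U E → E ∈F U
  ∈F-reflexive E∈U = _ , E∈U , ≐-refl

  ⊆F-trans : {U V W : Family X} → U ⊆F V → V ⊆F W → U ⊆F W
  ⊆F-trans U⊆V V⊆W E = V⊆W E ∘ U⊆V E

  ∩F-⊆F-left : (U H : Family X) → (U ∩F H) ⊆F U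
  ∩F-⊆F-left U H E (F , (F∈U , _) , F≐E) = ∈F-resp-≐ F∈U F≐E

  C₁-mono : {U V : Family X} → U ⊆F V → C₁ U ⊆F C₁ V
  C₁-mono U⊆V E (E′ , (E₁ , E₂ , E₁∈U , E₂∈U , shape) , E′≐E)
    with U⊆V E₁ (∈F-reflexive E₁∈U) | U⊆V E₂ (∈F-reflexive E₂∈U)
  ... | F₁ , F₁∈V , F₁≐E₁ | F₂ , F₂∈V , F₂≐E₂ =
    E′ , (F₁ , F₂ , F₁∈V , F₂∈V , reshape shape) , E′≐E
    where
    E₁≐F₁ : E₁ ≐ F₁
    E₁≐F₁ = ≐-sym F₁≐E₁

    E₂≐F₂ : E₂ ≐ F₂
    E₂≐F₂ = ≐-sym F₂≐E₂

    reshape : (E′ ≐ (E₁ ∩ E₂)) ⊎ (E′ ≐ (E₁ ∪ E₂)) ⊎ (E′ ≐ ∁ E₁) →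
              (E′ ≐ (F₁ ∩ F₂)) ⊎ (E′ ≐ (F₁ ∪ F₂)) ⊎ (E′ ≐ ∁ F₁)
    reshape (inj₁ eq)        = inj₁ (≐-trans eq (∩-cong E₁≐F₁ E₂≐F₂))
    reshape (inj₂ (inj₁ eq)) = inj₂ (inj₁ (≐-trans eq (∪-cong E₁≐F₁ E₂≐F₂)))
    reshape (inj₂ (inj₂ eq)) = inj₂ (inj₂ (≐-trans eq (∁-cong E₁≐F₁)))

  C-mono : (n : ℕ) {U V : Family X} → U ⊆F V → C n U ⊆F C n V
  C-mono zero    U⊆V = U⊆V
  C-mono (suc n) U⊆V = C₁-mono (C-mono n U⊆V)

  C₁-extensive : (U : Family X) → U ⊆F C₁ U
  C₁-extensive U E (F , F∈U , F≐E) =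
    F , (F , F , F∈U , F∈U , inj₁ ((λ x → x , x) , proj₁)) , F≐E

  C-extensive : (n : ℕ) (U : Family X) → U ⊆F C n U
  C-extensive zero    U = λ _ E∈U → E∈U
  C-extensive (suc n) U = ⊆F-trans (C-extensive n U) (C₁-extensive (C n U))

  MinimalConstructible-⊆F : ExcludedMiddle (lsuc ℓ) → (n : ℕ) {U W : Family X} →
    W ⊆F U → MinimalConstructible n U → MinimalConstructible n W
  MinimalConstructible-⊆F em n {U} {W} W⊆U minU K (K⊆W , E , E∈W , E∉K) W⊆CK =
    minU K′ (K′⊆U , E , W⊆U E E∈W , E∉K′) U⊆CK′
    where
    K′ : Family X
    K′ F = K F ⊎ (F ∈F U × ¬ (F ∈F W))

    K⊆K′ : K ⊆F K′
    K⊆K′ F (G , G∈K , G≐F) = G , inj₁ G∈K , G≐F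

    K′⊆U : K′ ⊆F U
    K′⊆U F (G , inj₁ G∈K , G≐F)       = W⊆U F (K⊆W F (G , G∈K , G≐F))
    K′⊆U F (G , inj₂ (G∈U , _) , G≐F) = ∈F-resp-≐ G∈U G≐F

    E∉K′ : ¬ (E ∈F K′)
    E∉K′ (G , inj₁ G∈K , G≐E)       = E∉K (G , G∈K , G≐E)
    E∉K′ (G , inj₂ (_ , G∉W) , G≐E) = G∉W (∈F-resp-≐ E∈W (≐-sym G≐E))

    U⊆CK′ : U ⊆F C n K′
    U⊆CK′ F F∈U with em {F ∈F W}
    ... | yes F∈W = C-mono n K⊆K′ F (W⊆CK F F∈W)
    ... | no  F∉W = C-extensive n K′ F (∈F-reflexive (inj₂ (F∈U , F∉W)))

corollary6p10 : ∀ {ℓ : Level} → ExcludedMiddle (lsuc ℓ) →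
    (X : Set ℓ) → X → (n : ℕ) → 1 ≤ n → (U H : Family X) →
    MinimalConstructible n U → MinimalConstructible n H →
    MinimalConstructible n (U ∩F H)
corollary6p10 em X _ n _ U H minU _ =
  MinimalConstructible-⊆F em n (∩F-⊆F-left U H) minU
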